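{- Let $G$ be a finite group (not necessarily abelian, written additively) of even order $q$, and let $f: G\to G$ be two-to-one. Then \[\operatorname{PR}(f)\le \left\lceil 2\sqrt{q}\right\rceil-1.\] Moreover, when $q$ is a perfect square, \[\operatorname{PR}(f)\le 2\sqrt{q}-2.\]
   Context: For a function $g: G\to G$, write $\operatorname{Im}(g)=\{g(x): x\in G\}$ and $V(g)=\#\operatorname{Im}(g)$. A permutation of $G$ is a bijection $G\to G$. For functions $g,f:G\to G$, $g+f$ denotes the function $x\mapsto g(x)+f(x)$. The permutation resemblance of $f: G\to G$ is \[\operatorname{PR}(f)=\min\{V(g)\,:\, g:G\to G \text{ such that } g+f \text{ is a permutation of } G\},\] equivalently the minimum of $\#\{f(x)-h(x): x\in G\}$ over all permutations $h$ of $G$. A function $f:G\to G$ is two-to-one if every element of $\operatorname{Im}(f)$ has exactly two preimages under $f$. -}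

module Defs where

open import Data.Nat using (ℕ; zero; suc; _*_; _≤?_)
open import Data.Fin using (Fin)
open import Data.Fin.Properties using (_≟_; any?)
open import Data.List using (List; length; filter)
open import Data.List.Base using (allFin)
open import Data.Product using (∃; Σ; _×_)
open import Function.Definitions using (Bijective)
open import Relation.Binary.PropositionalEquality using (_≡_)
open import Relation.Nullary using (does)
open import Algebra.Core using (Op₂)
import Data.Nat
import Data.Bool

-- A finite group of order q is represented by a group structure on Fin q
-- (every finite group of order q is isomorphic to one of these).

V : {q : ℕ} → (Fin q → Fin q) → ℕ
V {q} g = length (filter (λ y → any? (λ x → g x ≟ y)) (allFin q))

preimages : {q : ℕ} → (Fin q → Fin q) → Fin q → ℕ
preimages {q} f y = length (filter (λ x → f x ≟ y) (allFin q))

TwoToOne : {q : ℕ} → (Fin q → Fin q) → Set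
TwoToOne {q} f = (y : Fin q) → (∃ λ x → f x ≡ y) → preimages f y ≡ 2

_⊕[_]_ : {q : ℕ} → (Fin q → Fin q) → Op₂ (Fin q) → (Fin q → Fin q) → (Fin q → Fin q)
(g ⊕[ _+_ ] f) x = g x + f x

IsPermutation : {q : ℕ} → (Fin q → Fin q) → Set
IsPermutation h = Bijective _≡_ _≡_ h

-- PR(f) ≤ k, i.e. min { V(g) | g + f is a permutation } ≤ k, unfolded:
-- some g with g + f a permutation has V(g) ≤ k.
PR≤ : {q : ℕ} → Op₂ (Fin q) → (Fin q → Fin q) → ℕ → Set
PR≤ {q} _+_ f k = Σ (Fin q → Fin q) λ g → IsPermutation (g ⊕[ _+_ ] f) × Data.Nat._≤_ (V g) k

ceilSqrtAux : ℕ → ℕ → ℕ → ℕ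
ceilSqrtAux zero n m = n
ceilSqrtAux (suc fuel) n m with does (m ≤? n * n)
... | Data.Bool.true = n
... | Data.Bool.false = ceilSqrtAux fuel (suc n) m

ceilSqrt : ℕ → ℕ
ceilSqrt m = ceilSqrtAux (suc m) 0 m

-- ⌈2√q⌉ = ⌈√(4q)⌉
ceil2Sqrt : ℕ → ℕ
ceil2Sqrt q = ceilSqrt (4 * q)

{-# OPTIONS --safe #-}
-- Write q = 2h and N = q − 1. Choose one preimage of every value of f and put g = 0 there: g + f
-- maps these h representatives bijectively onto Im f. The other h points, the duplicates, have
-- distinct values and must be sent by g + f injectively into the h non-values. Do it greedily:
-- with r duplicates S still unmatched and free targets F, |F| ≥ r, the shifts t give together
-- |S| |F| ≥ r² pairs (x, t) with t + f x ∈ F, and t = 0 gives none since f x ∉ F; so some t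
-- serves r²/N of them, and g = t there. Hence r ↦ r − r²/N starting from r ≤ h, so after J rounds
-- at most N h / (N + J h) points remain, and R more rounds (one point each) finish as soon as
-- N h < (R + 1)(N + J h). This holds when (J + 1)(R + 1) ≥ q, which can be arranged with
-- J + R + 2 = ⌈2√q⌉, and also when q = m² ≥ 9, J = m − 2, R = m − 1; g then takes J + R + 1 values.
module Submission where

open import Defs
open import Data.Nat using (ℕ; zero; suc; _+_; _*_; _∸_; _≤_; _<_; z≤n; s≤s; _≤?_; _≤ᵇ_)
open import Data.Nat.Divisibility using (_∣_; divides)
open import Data.Fin using (Fin)
open import Data.Product using (_×_; ∃; _,_; proj₁; proj₂)
open import Algebra.Core using (Op₁; Op₂)
open import Algebra.Structures using (IsGroup)
open import Algebra.Bundles using (Group)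
open import Level using (0ℓ)
open import Relation.Binary.PropositionalEquality using (_≡_)

open import Data.Nat.Properties hiding (_≟_)
open import Data.Bool.Base using (Bool; true; false; T; _∧_; _∨_; not)
open import Data.Bool.Properties using (T-∧; T-≡; ∧-zeroʳ; ∧-identityʳ)
open import Data.Fin.Base using (zero; suc; punchIn; punchOut)
open import Data.Fin.Properties using (_≟_; any?; punchOut-injective; injective⇒≤)
import Data.Fin.Permutation as Permutation
open import Data.Vec.Functional using (removeAt)
open import Data.List.Base using (List; []; _∷_; length; filter; tabulate; allFin)
open import Data.List.Membership.Propositional using (_∈_)
open import Data.List.Relation.Unary.Any using (here; there)
open import Data.Sum using (inj₁; inj₂)
open import Data.Nat.Tactic.RingSolver using (solve-∀)
open import Function.Base using (_∘_)
open import Function.Bundles using (Equivalence)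
open import Function.Definitions using (Injective; Surjective)
open import Relation.Nullary.Negation using (¬_; contradiction)
open import Relation.Nullary.Decidable using (Dec; yes; no; does; T?; _×-dec_)
open import Relation.Binary.PropositionalEquality using (_≢_; refl; sym; trans; cong; subst; module ≡-Reasoning)
open import Algebra.Properties.CommutativeMonoid.Sum +-0-commutativeMonoid
  using (sum; sum-cong-≗; ∑-distrib-+; ∑-comm; sum-remove; sum-permute)
open import Algebra.Properties.Semiring.Sum +-*-semiring using (*-distribʳ-sum)

open Equivalence using (to; from)

dec-sound : ∀ {a} {A : Set a} (a? : Dec A) → T (does a?) → A
dec-sound (yes a) _ = a

dec-complete : ∀ {a} {A : Set a} (a? : Dec A) → A → T (does a?)
dec-complete (yes _) _ = _
dec-complete (no ¬a) a = ¬a a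

dec-sound-not : ∀ {a} {A : Set a} (a? : Dec A) → T (not (does a?)) → ¬ A
dec-sound-not (no ¬a) _ = ¬a

T-not⁺ : ∀ {b} → ¬ T b → T (not b)
T-not⁺ {false} _  = _
T-not⁺ {true}  ¬b = ¬b _

T-not⁻ : ∀ {b} → T (not b) → ¬ T b
T-not⁻ {false} _ ()

sum-mono-≤ : ∀ {n} {u v : Fin n → ℕ} → (∀ i → u i ≤ v i) → sum u ≤ sum v
sum-mono-≤ {zero}  _   = z≤n
sum-mono-≤ {suc n} u≤v = +-mono-≤ (u≤v zero) (sum-mono-≤ (u≤v ∘ suc))

sum-const : ∀ n k → sum {n} (λ _ → k) ≡ n * k
sum-const zero    k = refl
sum-const (suc n) k = cong (k +_) (sum-const n k)

argmax : ∀ {n} (u : Fin (suc n) → ℕ) → ∃ λ j → ∀ i → u i ≤ u j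
argmax {zero}  u = zero , λ { zero → ≤-refl }
argmax {suc n} u with j , max ← argmax (u ∘ suc) | u zero ≤? u (suc j)
... | yes u₀≤ = suc j , λ { zero → u₀≤ ; (suc i) → max i }
... | no  u₀≰ = zero  , λ { zero → ≤-refl ; (suc i) → ≤-trans (max i) (<⇒≤ (≰⇒> u₀≰)) }

exists-above-average : ∀ {N} (u : Fin (suc N) → ℕ) (i : Fin (suc N)) → u i ≡ 0 →
                       ∃ λ j → sum u ≤ N * u j
exists-above-average {zero}  u i uᵢ≡0 = i , ≤-reflexive (trans (sum-remove {i = i} u) (cong (_+ 0) uᵢ≡0))
exists-above-average {suc N} u i uᵢ≡0 with j , max ← argmax (removeAt u i) = punchIn i j , (begin
  sum u                          ≡⟨ sum-remove {i = i} u ⟩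
  u i + sum (removeAt u i)       ≡⟨ cong (_+ sum (removeAt u i)) uᵢ≡0 ⟩
  sum (removeAt u i)             ≤⟨ sum-mono-≤ max ⟩
  sum {suc N} (λ _ → u (punchIn i j)) ≡⟨ sum-const (suc N) _ ⟩
  suc N * u (punchIn i j)        ∎)
  where open ≤-Reasoning

indicator : Bool → ℕ
indicator true  = 1
indicator false = 0

count : ∀ {n} → (Fin n → Bool) → ℕ
count P = sum (indicator ∘ P)

indicator-mono : ∀ {a b} → (T a → T b) → indicator a ≤ indicator b
indicator-mono {false}         _   = z≤n
indicator-mono {true} {true}   _   = ≤-refl
indicator-mono {true} {false} a⇒b = contradiction _ a⇒b

indicator-∨ : ∀ a b → indicator (a ∨ b) ≤ indicator a + indicator b
indicator-∨ true  _ = s≤s z≤n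
indicator-∨ false _ = ≤-refl

indicator-split : ∀ a b → indicator a ≡ indicator (a ∧ b) + indicator (a ∧ not b)
indicator-split true  true  = refl
indicator-split true  false = refl
indicator-split false _     = refl

count-mono : ∀ {n} {P Q : Fin n → Bool} → (∀ {x} → T (P x) → T (Q x)) → count P ≤ count Q
count-mono {P = P} {Q} P⇒Q = sum-mono-≤ {u = indicator ∘ P} {v = indicator ∘ Q} λ _ → indicator-mono P⇒Q

count-none : ∀ {n} {P : Fin n → Bool} → (∀ x → ¬ T (P x)) → count P ≡ 0
count-none {zero}          _    = refl
count-none {suc n} {P} none with P zero | none zero
... | false | _  = count-none (none ∘ suc)
... | true  | ¬p = contradiction _ ¬p

count-cong : ∀ {n} {P Q : Fin n → Bool} → (∀ x → P x ≡ Q x) → count P ≡ count Q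
count-cong {P = P} {Q} P≗Q = sum-cong-≗ {x = indicator ∘ P} {y = indicator ∘ Q} (cong indicator ∘ P≗Q)

count-split : ∀ {n} (P Q : Fin n → Bool) →
              count P ≡ count (λ x → P x ∧ Q x) + count (λ x → P x ∧ not (Q x))
count-split P Q = trans (sum-cong-≗ λ x → indicator-split (P x) (Q x)) (∑-distrib-+ (λ x → indicator (P x ∧ Q x)) (λ x → indicator (P x ∧ not (Q x))))

count-true : ∀ {n} → count {n} (λ _ → true) ≡ n
count-true {zero}  = refl
count-true {suc n} = cong suc count-true

count-complement : ∀ {n} (P : Fin n → Bool) → count P + count (not ∘ P) ≡ n
count-complement P = trans (sym (count-split (λ _ → true) P)) count-true

count-≟ : ∀ {n} (a : Fin n) → count (λ x → does (x ≟ a)) ≡ 1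
count-≟ {suc n} zero    = cong suc (count-none {n} λ _ ())
count-≟ {suc n} (suc a) = count-≟ a

count-remove : ∀ {n} (P : Fin n → Bool) (a : Fin n) → T (P a) →
               count P ≡ suc (count (λ x → P x ∧ not (does (x ≟ a))))
count-remove P a Pa = begin
  count P                                         ≡⟨ count-split P (λ x → does (x ≟ a)) ⟩
  count (λ x → P x ∧ does (x ≟ a)) + count others ≡⟨ cong (_+ count others) (count-cong at-a) ⟩
  count (λ x → does (x ≟ a)) + count others       ≡⟨ cong (_+ count others) (count-≟ a) ⟩
  suc (count others)                              ∎
  where
  open ≡-Reasoning
  others : Fin _ → Bool
  others x = P x ∧ not (does (x ≟ a))
  at-a : ∀ x → P x ∧ does (x ≟ a) ≡ does (x ≟ a)
  at-a x with x ≟ a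
  ... | no  _    = ∧-zeroʳ (P x)
  ... | yes refl = trans (∧-identityʳ (P a)) (to T-≡ Pa)

count-≤1 : ∀ {n} {P : Fin n → Bool} → (∀ {x y} → T (P x) → T (P y) → x ≡ y) → count P ≤ 1
count-≤1 {P = P} unique with any? (λ x → T? (P x))
... | no  none     = ≤-trans (≤-reflexive (count-none λ x Px → none (x , Px))) z≤n
... | yes (a , Pa) = ≤-reflexive (trans (count-remove P a Pa) (cong suc (count-none only-a)))
  where
  only-a : ∀ x → ¬ T (P x ∧ not (does (x ≟ a)))
  only-a x h with Px , x≢a ← to T-∧ h = dec-sound-not (x ≟ a) x≢a (unique Px Pa)

count-pos : ∀ {n} (P : Fin n → Bool) (a : Fin n) → T (P a) → 1 ≤ count P
count-pos P a Pa = subst (1 ≤_) (sym (count-remove P a Pa)) (s≤s z≤n)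

three≤count : ∀ {n} (P : Fin n → Bool) {a b c : Fin n} → T (P a) → T (P b) → T (P c) →
              a ≢ b → a ≢ c → b ≢ c → 3 ≤ count P
three≤count P {a} {b} {c} Pa Pb Pc a≢b a≢c b≢c = begin
  3                                     ≤⟨ s≤s (s≤s (count-pos (P ─ a ─ b) c (keep (P ─ a) (keep P Pc (a≢c ∘ sym)) (b≢c ∘ sym)))) ⟩
  suc (suc (count (P ─ a ─ b)))         ≡⟨ cong suc (count-remove (P ─ a) b (keep P Pb (a≢b ∘ sym))) ⟨
  suc (count (P ─ a))                   ≡⟨ count-remove P a Pa ⟨
  count P                               ∎
  where
  open ≤-Reasoning
  infixl 6 _─_
  _─_ : (Fin _ → Bool) → Fin _ → Fin _ → Bool
  (Q ─ y) x = Q x ∧ not (does (x ≟ y))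
  keep : ∀ Q {x y} → T (Q x) → x ≢ y → T ((Q ─ y) x)
  keep Q {x} {y} Qx x≢y = from T-∧ (Qx , T-not⁺ (x≢y ∘ dec-sound (x ≟ y)))

count-injection : ∀ {n} {P Q : Fin n → Bool} (φ : Fin n → Fin n) →
                  (∀ {x} → T (P x) → T (Q (φ x))) →
                  (∀ {x y} → T (P x) → T (P y) → φ x ≡ φ y → x ≡ y) →
                  count P ≤ count Q
count-injection {n} {P} {Q} φ P⇒Qφ φ-injective = begin
  sum (indicator ∘ P)                            ≡⟨ sum-cong-≗ {x = indicator ∘ P} {y = λ x → count (fibre x)} (sym ∘ count-fibre) ⟩
  sum (λ x → count (fibre x))                    ≡⟨ ∑-comm (λ x y → indicator (fibre x y)) ⟩
  sum (λ y → count (λ x → fibre x y))            ≤⟨ sum-mono-≤ {u = λ y → count (λ x → fibre x y)} {v = indicator ∘ Q} count-preimage ⟩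
  count Q                                        ∎
  where
  open ≤-Reasoning
  fibre : Fin _ → Fin _ → Bool
  fibre x y = P x ∧ does (y ≟ φ x)
  count-fibre : ∀ x → count (fibre x) ≡ indicator (P x)
  count-fibre x with P x
  ... | true  = count-≟ (φ x)
  ... | false = count-none {n} {λ _ → false} λ _ ()
  count-preimage : ∀ y → count (λ x → fibre x y) ≤ indicator (Q y)
  count-preimage y with T? (Q y)
  ... | yes Qy = ≤-trans (count-≤1 unique) (indicator-mono λ _ → Qy)
    where
    unique : ∀ {x x′} → T (fibre x y) → T (fibre x′ y) → x ≡ x′
    unique h h′ with Px , y≡φx ← to T-∧ h | Px′ , y≡φx′ ← to T-∧ h′ =
      φ-injective Px Px′ (trans (sym (dec-sound (y ≟ φ _) y≡φx)) (dec-sound (y ≟ φ _) y≡φx′))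
  ... | no ¬Qy = ≤-trans (≤-reflexive (count-none empty)) z≤n
    where
    empty : ∀ x → ¬ T (fibre x y)
    empty x h with Px , y≡φx ← to T-∧ h =
      ¬Qy (subst (T ∘ Q) (sym (dec-sound (y ≟ φ x) y≡φx)) (P⇒Qφ Px))

count-permute : ∀ {n} (P : Fin n → Bool) {π π⁻¹ : Fin n → Fin n} →
                (∀ y → π (π⁻¹ y) ≡ y) → (∀ x → π⁻¹ (π x) ≡ x) → count (P ∘ π) ≡ count P
count-permute P {π} {π⁻¹} inverseˡ inverseʳ =
  sym (sum-permute (indicator ∘ P) (Permutation.permutation π π⁻¹ inverseˡ inverseʳ))

length-filter-tabulate : ∀ {m n p} {P : Fin n → Set p} (P? : ∀ x → Dec (P x)) (h : Fin m → Fin n) →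
                         length (filter P? (tabulate h)) ≡ count (λ i → does (P? (h i)))
length-filter-tabulate {zero}  P? h = refl
length-filter-tabulate {suc m} P? h with does (P? (h zero))
... | true  = cong suc (length-filter-tabulate P? (h ∘ suc))
... | false = length-filter-tabulate P? (h ∘ suc)

length-filter-allFin : ∀ {n p} {P : Fin n → Set p} (P? : ∀ x → Dec (P x)) →
                       length (filter P? (allFin n)) ≡ count (λ x → does (P? x))
length-filter-allFin P? = length-filter-tabulate P? (λ x → x)

module _ {n : ℕ} where
  open import Data.List.Membership.DecPropositional (_≟_ {n}) using (_∈?_)

  count-∈ : (L : List (Fin n)) → count (λ y → does (y ∈? L)) ≤ length L
  count-∈ []      = ≤-reflexive (count-none {n} {λ _ → false} λ _ ())
  count-∈ (a ∷ L) = begin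
    count (λ y → does (y ≟ a) ∨ does (y ∈? L))
      ≤⟨ sum-mono-≤ {u = λ y → indicator (does (y ≟ a) ∨ does (y ∈? L))}
                    {v = λ y → indicator (does (y ≟ a)) + indicator (does (y ∈? L))}
                    (λ y → indicator-∨ (does (y ≟ a)) (does (y ∈? L))) ⟩
    sum (λ y → indicator (does (y ≟ a)) + indicator (does (y ∈? L)))
      ≡⟨ ∑-distrib-+ (λ y → indicator (does (y ≟ a))) (λ y → indicator (does (y ∈? L))) ⟩
    count (λ y → does (y ≟ a)) + count (λ y → does (y ∈? L))
      ≡⟨ cong (_+ count (λ y → does (y ∈? L))) (count-≟ a) ⟩
    suc (count (λ y → does (y ∈? L)))
      ≤⟨ s≤s (count-∈ L) ⟩
    suc (length L) ∎
    where open ≤-Reasoning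

  V≤length : (g : Fin n → Fin n) (L : List (Fin n)) → (∀ x → g x ∈ L) → V g ≤ length L
  V≤length g L g∈L = begin
    V g                                         ≡⟨ length-filter-allFin (λ y → any? λ x → g x ≟ y) ⟩
    count (λ y → does (any? λ x → g x ≟ y))    ≤⟨ count-mono {P = λ y → does (any? λ x → g x ≟ y)} image⊆L ⟩
    count (λ y → does (y ∈? L))                ≤⟨ count-∈ L ⟩
    length L                                    ∎
    where
    open ≤-Reasoning
    image⊆L : ∀ {y} → T (does (any? λ x → g x ≟ y)) → T (does (y ∈? L))
    image⊆L {y} h with x , refl ← dec-sound (any? λ x → g x ≟ y) h = dec-complete (g x ∈? L) (g∈L x)


injective⇒surjective : ∀ {n} (h : Fin n → Fin n) → Injective _≡_ _≡_ h → Surjective _≡_ _≡_ h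
injective⇒surjective {zero}  h _           ()
injective⇒surjective {suc m} h h-injective y with any? (λ x → h x ≟ y)
... | yes (x , hx≡y) = x , λ { refl → hx≡y }
... | no  y∉image    = contradiction (injective⇒≤ avoid-injective) 1+n≰n
  where
  avoid : Fin (suc m) → Fin m
  avoid x = punchOut {i = y} (λ y≡hx → y∉image (x , sym y≡hx))
  avoid-injective : Injective _≡_ _≡_ avoid
  avoid-injective eq = h-injective (punchOut-injective {i = y} _ _ eq)

module _ {n : ℕ} (P : Fin n → Bool) (φ : Fin n → Fin n) where

  -- Opaque because with-abstractions over predicates built from image would otherwise unfold any?.
  opaque
    image : Fin n → Bool
    image y = does (any? λ x → T? (P x) ×-dec (φ x ≟ y))

    image-intro : ∀ {x} → T (P x) → T (image (φ x))
    image-intro {x} Px = dec-complete (any? λ z → T? (P z) ×-dec (φ z ≟ φ x)) (x , Px , refl)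

    image-elim : ∀ {y} → T (image y) → ∃ λ x → T (P x) × φ x ≡ y
    image-elim {y} = dec-sound (any? λ x → T? (P x) ×-dec (φ x ≟ y))

    preimage : Fin n → Fin n
    preimage y with any? (λ x → T? (P x) ×-dec (φ x ≟ y))
    ... | yes (x , _) = x
    ... | no  _       = y

    preimage-spec : ∀ {y} → T (image y) → T (P (preimage y)) × φ (preimage y) ≡ y
    preimage-spec {y} y∈image with any? (λ x → T? (P x) ×-dec (φ x ≟ y)) | y∈image
    ... | yes (_ , Px , φx≡y) | _ = Px , φx≡y

  count-image : count image ≤ count P
  count-image = count-injection preimage (proj₁ ∘ preimage-spec) λ y∈ y′∈ eq →
    trans (sym (proj₂ (preimage-spec y∈))) (trans (cong φ eq) (proj₂ (preimage-spec y′∈)))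

-- Rounds N r k: every run of the recursion r ↦ r′, where r′ ≤ r and r² ≤ N (r − r′), starting
-- from r stops at 0 within k steps.
data Rounds (N : ℕ) : ℕ → ℕ → Set where
  done  : ∀ {k} → Rounds N 0 k
  round : ∀ {r k} → (∀ r′ → r′ ≤ r → r * r ≤ N * (r ∸ r′) → Rounds N r′ k) → Rounds N r (suc k)

Rounds≤ : ℕ → ℕ → ℕ → Set
Rounds≤ N h k = ∀ {r} → r ≤ h → Rounds N r k

rounds-≤ : ∀ {N r k} → r ≤ k → Rounds N r k
rounds-≤ {r = zero}          _         = done
rounds-≤ {N} {suc r} {suc k} (s≤s r≤k) = round λ r′ r′≤1+r progress → rounds-≤ (≤-trans (decreases r′≤1+r progress) r≤k)
  where
  decreases : ∀ {r′} → r′ ≤ suc r → suc r * suc r ≤ N * (suc r ∸ r′) → r′ ≤ r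
  decreases r′≤1+r progress with m≤n⇒m<n∨m≡n r′≤1+r
  ... | inj₁ r′<1+r = ≤-pred r′<1+r
  ... | inj₂ refl   = contradiction (subst (suc r * suc r ≤_) (trans (cong (N *_) (n∸n≡0 (suc r))) (*-zeroʳ N)) progress) λ ()

-- In cleared-denominator form: r ≤ N h / M and r′ ≤ r − r² / N give r′ ≤ N h / (M + h).
bound-propagates : ∀ {N h M r r′} → r * M ≤ N * h → r * r ≤ N * (r ∸ r′) → r′ ≤ r → r′ * (M + h) ≤ N * h
bound-propagates {r = zero} _ _ z≤n = z≤n
bound-propagates {N} {h} {M} {r@(suc _)} {r′} rM≤Nh progress r′≤r = *-cancelˡ-≤ r (begin
  r * (r′ * (M + h))          ≡⟨ expand r r′ M h ⟩
  r′ * (r * M) + h * (r * r′) ≤⟨ +-monoˡ-≤ (h * (r * r′)) (*-monoʳ-≤ r′ rM≤Nh) ⟩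
  r′ * (N * h) + h * (r * r′) ≡⟨ collect r r′ N h ⟩
  h * (N * r′ + r * r′)       ≤⟨ *-monoʳ-≤ h Nr′+rr′≤Nr ⟩
  h * (N * r)                 ≡⟨ swap r N h ⟩
  r * (N * h)                 ∎)
  where
  open ≤-Reasoning
  expand : ∀ r r′ M h → r * (r′ * (M + h)) ≡ r′ * (r * M) + h * (r * r′)
  expand = solve-∀
  collect : ∀ r r′ N h → r′ * (N * h) + h * (r * r′) ≡ h * (N * r′ + r * r′)
  collect = solve-∀
  swap : ∀ r N h → h * (N * r) ≡ r * (N * h)
  swap = solve-∀
  Nr′+rr′≤Nr : N * r′ + r * r′ ≤ N * r
  Nr′+rr′≤Nr = begin
    N * r′ + r * r′        ≤⟨ +-monoʳ-≤ (N * r′) (≤-trans (*-monoʳ-≤ r r′≤r) progress) ⟩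
    N * r′ + N * (r ∸ r′)  ≡⟨ *-distribˡ-+ N r′ (r ∸ r′) ⟨
    N * (r′ + (r ∸ r′))    ≡⟨ cong (N *_) (m+[n∸m]≡n r′≤r) ⟩
    N * r                  ∎

-- After i more rounds the bound r M ≤ N h has become r (N + J h) ≤ N h, so r ≤ R, and R single-point
-- rounds finish.
rounds-hyperbolic : ∀ {N h J R} → N * h < suc R * (N + J * h) →
                    ∀ i {M r} → r * M ≤ N * h → M + i * h ≡ N + J * h → Rounds N r (i + R)
rounds-hyperbolic {N} {h} {J} {R} enough zero {M} {r} rM≤Nh M≡ =
  rounds-≤ (≤-pred (*-cancelʳ-< (N + J * h) r (suc R) (≤-<-trans r[N+Jh]≤Nh enough)))
  where
  r[N+Jh]≤Nh : r * (N + J * h) ≤ N * h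
  r[N+Jh]≤Nh = subst (λ x → r * x ≤ N * h) (trans (sym (+-identityʳ M)) M≡) rM≤Nh
rounds-hyperbolic {N} {h} {J} {R} enough (suc i) {M} rM≤Nh M≡ = round λ r′ r′≤r progress →
  rounds-hyperbolic {J = J} {R} enough i (bound-propagates {N} {h} rM≤Nh progress r′≤r) (trans (+-assoc M h (i * h)) M≡)

rounds-balanced : ∀ {N h J R r} → N * h < suc R * (N + J * h) → r ≤ h → Rounds N r (J + R)
rounds-balanced {N} {h} {J} {R} enough r≤h =
  rounds-hyperbolic {J = J} {R} enough J (≤-trans (*-monoˡ-≤ N r≤h) (≤-reflexive (*-comm h N))) refl

-- For q = 4 the estimate above is too weak, but one round clears both points since 2² > 3 · 1.
rounds-order4 : Rounds≤ 3 2 1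
rounds-order4 {0} _ = done
rounds-order4 {1} _ = rounds-≤ ≤-refl
rounds-order4 {2} _ = round λ { 0 _ _ → done ; 1 _ (s≤s (s≤s (s≤s ()))) ; 2 _ () ; (suc (suc (suc _))) (s≤s (s≤s ())) _ }
rounds-order4 {suc (suc (suc _))} (s≤s (s≤s ()))

ceilSqrtAux-spec : ∀ fuel n m → m ≤ (n + fuel) * (n + fuel) → m ≤ ceilSqrtAux fuel n m * ceilSqrtAux fuel n m
ceilSqrtAux-spec zero       n m m≤ = subst (λ x → m ≤ x * x) (+-identityʳ n) m≤
ceilSqrtAux-spec (suc fuel) n m m≤ with m ≤ᵇ n * n in m≤ᵇn²
... | true  = ≤ᵇ⇒≤ m (n * n) (subst T (sym m≤ᵇn²) _)
... | false = ceilSqrtAux-spec fuel (suc n) m (subst (λ x → m ≤ x * x) (+-suc n fuel) m≤)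

ceilSqrt-spec : ∀ m → m ≤ ceilSqrt m * ceilSqrt m
ceilSqrt-spec m = ceilSqrtAux-spec (suc m) 0 m (≤-trans (n≤1+n m) (m≤m*n (suc m) (suc m)))

near-halves : ∀ s → ∃ λ a → ∃ λ b → a + b ≡ s × s * s ≤ 4 * (a * b) + 1
near-halves zero          = 0 , 0 , refl , z≤n
near-halves (suc zero)    = 0 , 1 , refl , s≤s z≤n
near-halves (suc (suc s)) with a , b , refl , s²≤ ← near-halves s = suc a , suc b , cong suc (+-suc a b) , (begin
  (2 + (a + b)) * (2 + (a + b))          ≡⟨ square-step a b ⟩
  (a + b) * (a + b) + 4 * (a + b + 1)    ≤⟨ +-monoˡ-≤ (4 * (a + b + 1)) s²≤ ⟩
  4 * (a * b) + 1 + 4 * (a + b + 1)      ≡⟨ product-step a b ⟩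
  4 * (suc a * suc b) + 1                ∎)
  where
  open ≤-Reasoning
  square-step : ∀ a b → (2 + (a + b)) * (2 + (a + b)) ≡ (a + b) * (a + b) + 4 * (a + b + 1)
  square-step = solve-∀
  product-step : ∀ a b → 4 * (a * b) + 1 + 4 * (a + b + 1) ≡ 4 * (suc a * suc b) + 1
  product-step = solve-∀

quarter-≤ : ∀ {x y} → 4 * x ≤ 4 * y + 1 → x ≤ y
quarter-≤ {x} {y} 4x≤4y+1 = ≮⇒≥ λ y<x → contradiction
  (+-cancelˡ-≤ (4 * y) 4 1 (≤-trans (≤-reflexive (+-comm (4 * y) 4)) (≤-trans (≤-reflexive (sym (*-suc 4 y))) (≤-trans (*-monoʳ-≤ 4 y<x) 4x≤4y+1))))
  λ { (s≤s ()) }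

module EvenOrder (h′ : ℕ) where

  h q N : ℕ
  h = suc h′
  q = h + h
  N = h′ + h

  product-suffices : ∀ {J R} → q ≤ suc R * suc J → N * h < suc R * (N + J * h)
  product-suffices {J} {R} q≤AB = +-cancelʳ-< (A * h) (N * h) (A * (N + J * h)) (begin-strict
    N * h + A * h                  <⟨ +-monoˡ-< (A * h) (m<n+m (N * h) {h} (s≤s z≤n)) ⟩
    h + N * h + A * h              ≤⟨ +-monoʳ-≤ (h + N * h) (m≤n+m (A * h) (A * h′)) ⟩
    h + N * h + (A * h′ + A * h)   ≡⟨ cong (h + N * h +_) (*-distribˡ-+ A h′ h) ⟨
    q * h + A * N                  ≤⟨ +-monoˡ-≤ (A * N) (*-monoˡ-≤ h q≤AB) ⟩
    A * suc J * h + A * N          ≡⟨ regroup A J h N ⟩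
    A * (N + J * h) + A * h        ∎)
    where
    open ≤-Reasoning
    A = suc R
    regroup : ∀ A J h N → A * suc J * h + A * N ≡ A * (N + J * h) + A * h
    regroup = solve-∀

  square-suffices : ∀ {m} → 3 ≤ m → m * m ≡ q → N * h < m * (N + (m ∸ 2) * h)
  square-suffices {0}                ()  _
  square-suffices {1}                (s≤s ()) _
  square-suffices {m@(suc (suc c))} 3≤m m²≡q = +-cancelʳ-< m (N * h) (m * (N + c * h)) (begin-strict
    N * h + m                      <⟨ +-monoʳ-< (N * h) m<h ⟩
    N * h + h                      ≡⟨ +-comm (N * h) h ⟩
    q * h                          ≡⟨ cong (_* h) m²≡q ⟨
    m * m * h                      ≡⟨ *-assoc m m h ⟩
    m * (m * h)                    ≡⟨ cong (m *_) (spread c h) ⟨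
    m * (h + h + c * h)            ≡⟨ absorb m N c h ⟨
    m * (N + c * h) + m            ∎)
    where
    open ≤-Reasoning
    spread : ∀ c h → h + h + c * h ≡ (2 + c) * h
    spread = solve-∀
    absorb : ∀ m N c h → m * (N + c * h) + m ≡ m * (suc N + c * h)
    absorb = solve-∀
    m<h : m < h
    m<h = ≰⇒> λ h≤m → <-irrefl refl (begin-strict
      h + h       ≤⟨ +-mono-≤ h≤m h≤m ⟩
      m + m       <⟨ +-monoʳ-< m (m<m+n m (s≤s z≤n)) ⟩
      3 * m       ≤⟨ *-monoˡ-≤ m 3≤m ⟩
      m * m       ≡⟨ m²≡q ⟩
      h + h       ∎)

  rounds-product : ∀ a b → q ≤ a * b → ∃ λ k → Rounds≤ N h k × suc k ≡ a + b ∸ 1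
  rounds-product zero    _       ()
  rounds-product (suc J) zero    q≤ = contradiction (subst (q ≤_) (*-zeroʳ (suc J)) q≤) λ ()
  rounds-product (suc J) (suc R) q≤ =
    J + R , rounds-balanced {J = J} {R} (product-suffices {J} {R} (subst (q ≤_) (*-comm (suc J) (suc R)) q≤)) , sym (+-suc J R)

  rounds-ceil : ∃ λ k → Rounds≤ N h k × suc k ≡ ceil2Sqrt q ∸ 1
  rounds-ceil with a , b , a+b≡s , s²≤4ab+1 ← near-halves (ceil2Sqrt q) =
    subst (λ s → ∃ λ k → Rounds≤ N h k × suc k ≡ s ∸ 1) a+b≡s
          (rounds-product a b (quarter-≤ (≤-trans (ceilSqrt-spec (4 * q)) s²≤4ab+1)))

  rounds-square : ∀ {m} → q ≡ m * m → ∃ λ k → Rounds≤ N h k × suc k ≡ 2 * m ∸ 2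
  rounds-square {0} ()
  rounds-square {1} q≡1 = contradiction (trans (sym (+-suc h′ h′)) (suc-injective q≡1)) λ ()
  rounds-square {2} q≡4 =
    1 , subst (λ h′ → Rounds≤ (h′ + suc h′) (suc h′) 1) (sym h′≡1) rounds-order4 , refl
    where
    h′≡1 : h′ ≡ 1
    h′≡1 = suc-injective (*-cancelˡ-≡ h 2 2 (trans (cong (h +_) (+-identityʳ h)) q≡4))
  rounds-square {m@(suc (suc (suc c)))} q≡m² =
    suc c + suc (suc c) , rounds-balanced (square-suffices (s≤s (s≤s (s≤s z≤n))) (sym q≡m²)) , cong suc (halve c)
    where
    halve : ∀ c → suc (c + suc (suc c)) ≡ c + (suc (suc (suc c)) + 0)
    halve = solve-∀

module Greedy {N : ℕ} {_∙_ : Op₂ (Fin (suc N))} {ε : Fin (suc N)} {_⁻¹ : Op₁ (Fin (suc N))}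
              (isGroup : IsGroup _≡_ _∙_ ε _⁻¹) (f : Fin (suc N) → Fin (suc N)) where

  private
    G : Set
    G = Fin (suc N)

    group : Group 0ℓ 0ℓ
    group = record { isGroup = isGroup }

  open IsGroup isGroup using (identityˡ)
  open import Algebra.Properties.Group group using (∙-cancelˡ; //-rightDividesˡ; //-rightDividesʳ)

  count-translate : (F : G → Bool) (a : G) → count (λ t → F (t ∙ a)) ≡ count F
  count-translate F a = count-permute F {_∙ a} {λ y → y ∙ (a ⁻¹)} (//-rightDividesˡ a) (//-rightDividesʳ a)

  hits : G → (G → Bool) → (G → Bool) → G → Bool
  hits t S F x = S x ∧ F (t ∙ f x)

  leftover : G → (G → Bool) → (G → Bool) → G → Bool
  leftover t S F x = S x ∧ not (F (t ∙ f x))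

  unused : G → (G → Bool) → (G → Bool) → G → Bool
  unused t S F y = F y ∧ not (image S (λ x → t ∙ f x) y)

  count-hits-at : (S F : G → Bool) (x : G) → count (λ t → hits t S F x) ≡ indicator (S x) * count F
  count-hits-at S F x with S x
  ... | true  = trans (count-translate F (f x)) (sym (+-identityʳ (count F)))
  ... | false = count-none {suc N} {λ _ → false} λ _ ()

  sum-count-hits : (S F : G → Bool) → sum (λ t → count (hits t S F)) ≡ count S * count F
  sum-count-hits S F = begin
    sum (λ t → count (hits t S F))             ≡⟨ ∑-comm (λ t x → indicator (hits t S F x)) ⟩
    sum (λ x → count (λ t → hits t S F x))     ≡⟨ sum-cong-≗ {x = λ x → count (λ t → hits t S F x)}
                                                              {y = λ x → indicator (S x) * count F} (count-hits-at S F) ⟩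
    sum (λ x → indicator (S x) * count F)      ≡⟨ *-distribʳ-sum (count F) (indicator ∘ S) ⟨
    count S * count F                          ∎
    where open ≡-Reasoning

  count-hits+leftover : ∀ t (S F : G → Bool) → count S ≡ count (hits t S F) + count (leftover t S F)
  count-hits+leftover t S F = count-split S (λ x → F (t ∙ f x))

  record Admissible (S F : G → Bool) : Set where
    field
      f-injective : ∀ {x y} → T (S x) → T (S y) → f x ≡ f y → x ≡ y
      f-avoids    : ∀ {x} → T (S x) → ¬ T (F (f x))
      fits        : count S ≤ count F

  record Matching (k : ℕ) (S F : G → Bool) : Set where
    field
      shift        : G → G
      shifts       : List G
      few          : length shifts ≤ k
      shift∈shifts : ∀ {x} → T (S x) → shift x ∈ shifts
      lands        : ∀ {x} → T (S x) → T (F (shift x ∙ f x))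
      injective    : ∀ {x y} → T (S x) → T (S y) → shift x ∙ f x ≡ shift y ∙ f y → x ≡ y

  no-hits-at-0 : ∀ {S F} → Admissible S F → count (hits ε S F) ≡ 0
  no-hits-at-0 {S} {F} adm = count-none λ x h → let Sx , F[0+fx] = to T-∧ h in
    Admissible.f-avoids adm Sx (subst (T ∘ F) (identityˡ (f x)) F[0+fx])

  good-shift : ∀ {S F} → Admissible S F → ∃ λ t → count S * count S ≤ N * count (hits t S F)
  good-shift {S} {F} adm with t , above ← exists-above-average (λ t → count (hits t S F)) ε (no-hits-at-0 adm) =
    t , (begin
      count S * count S               ≤⟨ *-monoʳ-≤ (count S) (Admissible.fits adm) ⟩
      count S * count F               ≡⟨ sum-count-hits S F ⟨
      sum (λ t → count (hits t S F))  ≤⟨ above ⟩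
      N * count (hits t S F)          ∎)
    where open ≤-Reasoning

  leftover-admissible : ∀ {S F} t → Admissible S F → Admissible (leftover t S F) (unused t S F)
  leftover-admissible {S} {F} t adm = record
    { f-injective = λ x∈ y∈ → f-injective (proj₁ (to T-∧ x∈)) (proj₁ (to T-∧ y∈))
    ; f-avoids    = λ x∈ unused-fx → f-avoids (proj₁ (to T-∧ x∈)) (proj₁ (to T-∧ unused-fx))
    ; fits        = +-cancelˡ-≤ (count (hits t S F)) _ _ (begin
        count (hits t S F) + count (leftover t S F)  ≡⟨ count-hits+leftover t S F ⟨
        count S                                      ≤⟨ fits ⟩
        count F                                      ≡⟨ count-split F covered ⟩
        count (λ y → F y ∧ covered y) + count (unused t S F)
                                                     ≤⟨ +-monoˡ-≤ (count (unused t S F)) covered≤hits ⟩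
        count (hits t S F) + count (unused t S F)    ∎)
    }
    where
    open Admissible adm
    open ≤-Reasoning
    covered : G → Bool
    covered = image S (λ x → t ∙ f x)
    covered-hit : ∀ {y} → T (F y ∧ covered y) → T (image (hits t S F) (λ x → t ∙ f x) y)
    covered-hit {y} h with to T-∧ h
    ... | Fy , y∈ with image-elim S (λ x → t ∙ f x) {y} y∈
    ...   | x , Sx , refl = image-intro (hits t S F) (λ x → t ∙ f x) (from T-∧ (Sx , Fy))
    covered≤hits : count (λ y → F y ∧ covered y) ≤ count (hits t S F)
    covered≤hits = ≤-trans (count-mono {P = λ y → F y ∧ covered y} covered-hit) (count-image (hits t S F) (λ x → t ∙ f x))

  extend : ∀ {k S F} t → (∀ {x y} → T (S x) → T (S y) → f x ≡ f y → x ≡ y) →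
           Matching k (leftover t S F) (unused t S F) → Matching (suc k) S F
  extend {S = S} {F} t f-injective m = record
    { shift        = shift′
    ; shifts       = t ∷ shifts
    ; few          = s≤s few
    ; shift∈shifts = shift′∈
    ; lands        = lands′
    ; injective    = injective′
    }
    where
    open Matching m
    left : ∀ {x} → T (S x) → ¬ T (F (t ∙ f x)) → T (leftover t S F x)
    left Sx ¬hit = from T-∧ (Sx , T-not⁺ ¬hit)
    shift′ : G → G
    shift′ x with T? (F (t ∙ f x))
    ... | yes _ = t
    ... | no  _ = shift x
    shift′∈ : ∀ {x} → T (S x) → shift′ x ∈ t ∷ shifts
    shift′∈ {x} Sx with T? (F (t ∙ f x))
    ... | yes _    = here refl
    ... | no  ¬hit = there (shift∈shifts (left Sx ¬hit))
    lands′ : ∀ {x} → T (S x) → T (F (shift′ x ∙ f x))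
    lands′ {x} Sx with T? (F (t ∙ f x))
    ... | yes hit  = hit
    ... | no  ¬hit = proj₁ (to T-∧ (lands (left Sx ¬hit)))
    -- t ∙ f x is covered, whereas later shifts land in unused targets only.
    apart : ∀ {x y} → T (S x) → T (leftover t S F y) → ¬ t ∙ f x ≡ shift y ∙ f y
    apart Sx y-left eq = T-not⁻ (proj₂ (to T-∧ (lands y-left)))
      (subst (T ∘ image S (λ x → t ∙ f x)) eq (image-intro S (λ x → t ∙ f x) Sx))
    injective′ : ∀ {x y} → T (S x) → T (S y) → shift′ x ∙ f x ≡ shift′ y ∙ f y → x ≡ y
    injective′ {x} {y} Sx Sy eq with T? (F (t ∙ f x)) | T? (F (t ∙ f y))
    ... | yes _    | yes _    = f-injective Sx Sy (∙-cancelˡ t (f x) (f y) eq)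
    ... | no  ¬hit | no  ¬hit′ = injective (left Sx ¬hit) (left Sy ¬hit′) eq
    ... | yes _    | no  ¬hit′ = contradiction eq (apart Sx (left Sy ¬hit′))
    ... | no  ¬hit | yes _    = contradiction (sym eq) (apart Sy (left Sx ¬hit))

  nothing-to-match : ∀ {k S F} → count S ≡ 0 → Matching k S F
  nothing-to-match {S = S} none = record
    { shift = λ _ → ε ; shifts = [] ; few = z≤n
    ; shift∈shifts = absurd ; lands = absurd ; injective = λ Sx _ _ → absurd Sx
    }
    where
    absurd : ∀ {A : Set} {x} → T (S x) → A
    absurd {x = x} Sx = contradiction (trans (sym (count-remove S x Sx)) none) λ ()

  greedy : ∀ {r k S F} → Rounds N r k → count S ≡ r → Admissible S F → Matching k S F
  greedy done none _ = nothing-to-match none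
  greedy {S = S} {F} (round next) refl adm with t , progress ← good-shift adm =
    extend t (Admissible.f-injective adm)
      (greedy (next (count (leftover t S F)) leftover≤ (subst (λ c → count S * count S ≤ N * c) hits≡ progress))
              refl (leftover-admissible t adm))
    where
    leftover≤ : count (leftover t S F) ≤ count S
    leftover≤ = ≤-trans (m≤n+m (count (leftover t S F)) (count (hits t S F))) (≤-reflexive (sym (count-hits+leftover t S F)))
    hits≡ : count (hits t S F) ≡ count S ∸ count (leftover t S F)
    hits≡ = sym (trans (cong (_∸ count (leftover t S F)) (count-hits+leftover t S F)) (m+n∸n≡m (count (hits t S F)) (count (leftover t S F))))

module TwoToOneMatching {N : ℕ} {_∙_ : Op₂ (Fin (suc N))} {ε : Fin (suc N)} {_⁻¹ : Op₁ (Fin (suc N))}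
                        (isGroup : IsGroup _≡_ _∙_ ε _⁻¹) {f : Fin (suc N) → Fin (suc N)}
                        (twoToOne : TwoToOne f) where

  open Greedy isGroup f
  open IsGroup isGroup using (identityˡ)

  private
    G : Set
    G = Fin (suc N)

  values : G → Bool
  values = image (λ _ → true) f

  f∈values : ∀ x → T (values (f x))
  f∈values x = image-intro (λ _ → true) f {x} _

  chosen : G → G
  chosen = preimage (λ _ → true) f

  f-chosen : ∀ {y} → T (values y) → f (chosen y) ≡ y
  f-chosen y∈ = proj₂ (preimage-spec (λ _ → true) f y∈)

  representative : G → Bool
  representative x = does (chosen (f x) ≟ x)

  duplicate : G → Bool
  duplicate = not ∘ representative

  chosen-representative : ∀ x → T (representative (chosen (f x)))
  chosen-representative x = dec-complete (chosen (f (chosen (f x))) ≟ chosen (f x)) (cong chosen (f-chosen (f∈values x)))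

  fibre-size : ∀ x → count (λ z → does (f z ≟ f x)) ≡ 2
  fibre-size x = trans (sym (length-filter-allFin (λ z → f z ≟ f x))) (twoToOne (f x) (x , refl))

  -- Two duplicates with the same value would give it three preimages, the third being the chosen one.
  duplicate-injective : ∀ {x y} → T (duplicate x) → T (duplicate y) → f x ≡ f y → x ≡ y
  duplicate-injective {x} {y} dx dy fx≡fy with x ≟ y
  ... | yes x≡y = x≡y
  ... | no  x≢y = contradiction
    (subst (3 ≤_) (fibre-size x)
      (three≤count (λ z → does (f z ≟ f x)) (in-fibre refl) (in-fibre (sym fx≡fy)) (in-fibre (f-chosen (f∈values x)))
                   x≢y (c≢x ∘ sym) (c≢y ∘ sym)))
    λ { (s≤s (s≤s ())) }
    where
    in-fibre : ∀ {z} → f z ≡ f x → T (does (f z ≟ f x))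
    in-fibre {z} = dec-complete (f z ≟ f x)
    c≢x : chosen (f x) ≢ x
    c≢x = dec-sound-not (chosen (f x) ≟ x) dx
    c≢y : chosen (f x) ≢ y
    c≢y = subst (λ v → chosen v ≢ y) (sym fx≡fy) (dec-sound-not (chosen (f y) ≟ y) dy)

  values≤representatives : count values ≤ count representative
  values≤representatives = ≤-trans (count-mono {P = values} hit) (count-image representative f)
    where
    hit : ∀ {y} → T (values y) → T (image representative f y)
    hit {y} y∈ with x , _ , refl ← image-elim (λ _ → true) f y∈ =
      subst (T ∘ image representative f) (f-chosen (f∈values x)) (image-intro representative f (chosen-representative x))

  duplicates≤representatives : count duplicate ≤ count representative
  duplicates≤representatives = count-injection {P = duplicate} {Q = representative} (chosen ∘ f) (λ {x} _ → chosen-representative x) λ {x} {y} dx dy eq →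
    duplicate-injective dx dy (trans (sym (f-chosen (f∈values x))) (trans (cong f eq) (f-chosen (f∈values y))))

  duplicates-admissible : Admissible duplicate (not ∘ values)
  duplicates-admissible = record
    { f-injective = duplicate-injective
    ; f-avoids    = λ {x} _ fx∉values → T-not⁻ fx∉values (f∈values x)
    ; fits        = +-cancelˡ-≤ (count values) _ _ (begin
        count values + count duplicate          ≤⟨ +-monoˡ-≤ (count duplicate) values≤representatives ⟩
        count representative + count duplicate  ≡⟨ count-complement representative ⟩
        suc N                                   ≡⟨ count-complement values ⟨
        count values + count (not ∘ values)     ∎)
    }
    where open ≤-Reasoning

  duplicates≤half : ∀ {h} → suc N ≡ h + h → count duplicate ≤ h
  duplicates≤half {h} 1+N≡2h = ≮⇒≥ λ h<d → <-irrefl refl (begin-strict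
    h + h                                   <⟨ +-mono-< h<d h<d ⟩
    count duplicate + count duplicate       ≤⟨ +-monoˡ-≤ (count duplicate) duplicates≤representatives ⟩
    count representative + count duplicate  ≡⟨ count-complement representative ⟩
    suc N                                   ≡⟨ 1+N≡2h ⟩
    h + h                                   ∎)
    where open ≤-Reasoning

  pr≤-from-rounds : ∀ {h k} → suc N ≡ h + h → Rounds≤ N h k → PR≤ _∙_ f (suc k)
  pr≤-from-rounds 1+N≡2h rounds =
    g , (g+f-injective , injective⇒surjective (g ⊕[ _∙_ ] f) g+f-injective) , ≤-trans (V≤length g (ε ∷ shifts) g∈) (s≤s few)
    where
    matching : Matching _ duplicate (not ∘ values)
    matching = greedy (rounds (duplicates≤half 1+N≡2h)) refl duplicates-admissible
    open Matching matching
    g : G → G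
    g x with T? (representative x)
    ... | yes _ = ε
    ... | no  _ = shift x
    g∈ : ∀ x → g x ∈ ε ∷ shifts
    g∈ x with T? (representative x)
    ... | yes _  = here refl
    ... | no  ¬r = there (shift∈shifts (T-not⁺ ¬r))
    ε-cancel : ∀ {x y} → ε ∙ f x ≡ ε ∙ f y → f x ≡ f y
    ε-cancel {x} {y} eq = trans (sym (identityˡ (f x))) (trans eq (identityˡ (f y)))
    apart : ∀ {x y} → ¬ T (representative x) → ¬ shift x ∙ f x ≡ ε ∙ f y
    apart {x} {y} ¬r eq = T-not⁻ (lands (T-not⁺ ¬r)) (subst (T ∘ values) (sym (trans eq (identityˡ (f y)))) (f∈values y))
    g+f-injective : Injective _≡_ _≡_ (g ⊕[ _∙_ ] f)
    g+f-injective {x} {y} eq with T? (representative x) | T? (representative y)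
    ... | yes rx | yes ry = trans (sym (dec-sound (chosen (f x) ≟ x) rx))
                                  (trans (cong chosen (ε-cancel eq)) (dec-sound (chosen (f y) ≟ y) ry))
    ... | no ¬rx | no ¬ry = injective (T-not⁺ ¬rx) (T-not⁺ ¬ry) eq
    ... | yes _  | no ¬ry = contradiction (sym eq) (apart ¬ry)
    ... | no ¬rx | yes _  = contradiction eq (apart ¬rx)

half-order : ∀ {N h′} → suc N ≡ suc h′ * 2 → N ≡ h′ + suc h′
half-order {N} {h′} 1+N≡ = suc-injective (trans 1+N≡ (double h′))
  where
  double : ∀ h′ → suc h′ * 2 ≡ suc h′ + suc h′
  double = solve-∀

theorem1p1 : (q : ℕ) (_+_ : Op₂ (Fin q)) (0# : Fin q) (-_ : Op₁ (Fin q))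
    → IsGroup _≡_ _+_ 0# -_
    → 2 ∣ q
    → (f : Fin q → Fin q) → TwoToOne f
    → PR≤ _+_ f (ceil2Sqrt q ∸ 1)
    × ((m : ℕ) → q ≡ m * m → PR≤ _+_ f (2 * m ∸ 2))
theorem1p1 zero    _   () _ _ _ _ _
theorem1p1 (suc N) _∙_ _ _ isGroup (divides (suc h′) 1+N≡2h) f twoToOne = ceil-bound , square-bound
  where
  open EvenOrder h′ using (h; rounds-ceil; rounds-square)
  open TwoToOneMatching isGroup twoToOne using (pr≤-from-rounds)
  N≡ : N ≡ h′ + suc h′
  N≡ = half-order 1+N≡2h
  pr≤ : ∀ {k} → Rounds≤ (h′ + suc h′) h k → PR≤ _∙_ f (suc k)
  pr≤ {k} rounds = pr≤-from-rounds (cong suc N≡) (subst (λ n → Rounds≤ n h k) (sym N≡) rounds)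
  ceil-bound : PR≤ _∙_ f (ceil2Sqrt (suc N) ∸ 1)
  ceil-bound with k , rounds , 1+k≡ ← rounds-ceil =
    subst (PR≤ _∙_ f) (trans 1+k≡ (cong (λ q → ceil2Sqrt q ∸ 1) (sym (cong suc N≡)))) (pr≤ rounds)
  square-bound : (m : ℕ) → suc N ≡ m * m → PR≤ _∙_ f (2 * m ∸ 2)
  square-bound m 1+N≡m² with k , rounds , 1+k≡ ← rounds-square {m} (trans (sym (cong suc N≡)) 1+N≡m²) =
    subst (PR≤ _∙_ f) 1+k≡ (pr≤ rounds)
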